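{- Let $n\ge 2$ and $c^1,c^2\in\mathbb{N}_+^n$, and let $C^1:=\sum_{i=1}^n c^1_i$, $M:=C^1+1$. Construct the graph $G=(V,E)$ with weights $c=(c_1,c_2)\colon E\to\mathbb{Z}\times\mathbb{N}_+$: for each $i\in[n]$ create vertices $v_i,w_i,v_i'$ and edges $\{v_i,w_i\}$ with weight $(0,c^2_i+2)^\mathsf{T}$, $\{v_i,v_i'\}$ with weight $(0,1)^\mathsf{T}$ and $\{v_i',w_i\}$ with weight $(c^1_i,1)^\mathsf{T}$; for each $i\in[n-1]$ add the edge $\{w_i,v_{i+1}\}$ with weight $(0,1)^\mathsf{T}$; set $s:=v_1$, $t:=w_n$ and add the edge $\{s,t\}$ with weight $(M,1)^\mathsf{T}$. For $x\in\{0,1\}^n$ let $S_x\subseteq E$ consist of all edges $\{v_i,w_i\}$ and $\{v_i,v_i'\}$ for $i\in[n]$, all edges $\{w_i,v_{i+1}\}$ for $i\in[n-1]$, and the edge $\{v_i',w_i\}$ for exactly those $i\in[n]$ with $x_i=0$. Let $y=(-(c^1)^\mathsf{T}x,(c^2)^\mathsf{T}x)^\mathsf{T}$. Then $S_x$ is a spanner of $G$ and \[f_1(S_x)=C^1+y^1\quad\text{and}\quad f_2(S_x)=y^2+3n-1.\]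
   Context: $[n]=\{1,\dots,n\}$. A spanner of a connected undirected graph $G=(V,E)$ is a set $S\subseteq E$ such that $(V,S)$ is connected, with $f_1(S)=\sum_{e\in S}c_1(e)$ and $f_2(S)=\max_{u,v\in V,\,u\neq v}\frac{d^S_{c_2}(u,v)}{d^E_{c_2}(u,v)}$, where $d^F_{c_2}(u,v)$ is the $c_2$-length of a shortest $u$-$v$-path in $(V,F)$. -}

module Defs where

open import Data.Nat using (ℕ; zero; suc; _+_; _*_; _∸_)
open import Data.Integer as ℤ using (ℤ; +_; -_)
open import Data.Rational as ℚ using (ℚ; _/_; 0ℚ)
open import Data.Fin using (Fin; zero; suc; inject₁)
open import Data.Bool using (Bool; true; false; if_then_else_)
open import Data.List using (List; []; _∷_; _++_; map; filter; foldr)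
open import Data.List.Base using (allFin)
open import Data.Product using (_×_; _,_; Σ; ∃)
open import Data.Sum using (_⊎_)
open import Relation.Binary.PropositionalEquality using (_≡_; _≢_)
open import Relation.Nullary using (Dec; yes; no)

-- Edge subsets S ⊆ E are Boolean predicates on E.

module GraphNotions {V E : Set} (ends : E → V × V) (edges : List E)
                    (c₁ : E → ℤ) (c₂ : E → ℕ) where

  Joins : E → V → V → Set
  Joins e u x = (ends e ≡ (u , x)) ⊎ (ends e ≡ (x , u))

  data Walk (F : E → Bool) : V → V → Set where
    []  : ∀ {u} → Walk F u u
    step : ∀ {u x v} (e : E) → F e ≡ true → Joins e u x → Walk F x v → Walk F u v

  len : ∀ {F u v} → Walk F u v → ℕ
  len [] = 0
  len (step e _ _ p) = c₂ e + len p

  IsDist : (F : E → Bool) → V → V → ℕ → Set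
  IsDist F u v d = (Σ (Walk F u v) λ p → len p ≡ d)
                 × (∀ (p : Walk F u v) → d Data.Nat.≤ len p)

  allE : E → Bool
  allE _ = true

  Connected : (F : E → Bool) → Set
  Connected F = ∀ u v → Walk F u v

  -- S is a spanner: (V, S) connected (S ⊆ E automatically)
  IsSpanner : (E → Bool) → Set
  IsSpanner S = Connected S

  f₁ : (E → Bool) → ℤ
  f₁ S = foldr (λ e acc → (if S e then c₁ e else + 0) ℤ.+ acc) (+ 0) edges

  -- the rational a / b  (b = 0 never occurs for distinct vertices)
  ratio : ℕ → ℕ → ℚ
  ratio a zero = 0ℚ
  ratio a (suc b) = (+ a) / suc b

  -- "f₂(S) = q": q is the maximum over u ≠ v of d^S(u,v) / d^E(u,v)
  F₂Is : (E → Bool) → ℚ → Set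
  F₂Is S q =
      (∀ u v → u ≢ v → ∀ dS dE → IsDist S u v dS → IsDist allE u v dE →
         ratio dS dE ℚ.≤ q)
    × (Σ V λ u → Σ V λ v → u ≢ v × Σ ℕ λ dS → Σ ℕ λ dE →
         IsDist S u v dS × IsDist allE u v dE × ratio dS dE ≡ q)

-- The construction, with n = suc m vertices-triples indexed by Fin (suc m).

data Vtx (m : ℕ) : Set where
  v w v′ : Fin (suc m) → Vtx m

data Edg (m : ℕ) : Set where
  vw vv′ v′w : Fin (suc m) → Edg m
  wv : Fin m → Edg m
  st : Edg m

lastF : (m : ℕ) → Fin (suc m)
lastF zero = zero
lastF (suc m) = suc (lastF m)

ends : ∀ {m} → Edg m → Vtx m × Vtx m
ends (vw i) = v i , w i
ends (vv′ i) = v i , v′ i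
ends (v′w i) = v′ i , w i
ends (wv i) = w (inject₁ i) , v (suc i)
ends {m} st = v zero , w (lastF m)

edgeList : (m : ℕ) → List (Edg m)
edgeList m = map vw (allFin (suc m)) ++ map vv′ (allFin (suc m))
          ++ map v′w (allFin (suc m)) ++ map wv (allFin m) ++ (st ∷ [])

ΣF : ∀ {k} → (Fin k → ℕ) → ℕ
ΣF {zero} f = 0
ΣF {suc k} f = f zero + ΣF (λ i → f (suc i))

bit : Bool → ℕ
bit true = 1
bit false = 0

module Construction (m : ℕ) (c¹ c² : Fin (suc m) → ℕ) where

  C¹ : ℕ
  C¹ = ΣF c¹

  M : ℕ
  M = C¹ + 1

  w₁ : Edg m → ℤ
  w₁ (vw i) = + 0
  w₁ (vv′ i) = + 0
  w₁ (v′w i) = + c¹ i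
  w₁ (wv i) = + 0
  w₁ st = + M

  w₂ : Edg m → ℕ
  w₂ (vw i) = c² i + 2
  w₂ (vv′ i) = 1
  w₂ (v′w i) = 1
  w₂ (wv i) = 1
  w₂ st = 1

  open GraphNotions {Vtx m} {Edg m} ends (edgeList m) w₁ w₂ public

  S_ : (Fin (suc m) → Bool) → Edg m → Bool
  S_ x (v′w i) = if x i then false else true
  S_ x st = false
  S_ x _ = true

  y¹ : (Fin (suc m) → Bool) → ℤ
  y¹ x = - (+ ΣF (λ i → c¹ i * bit (x i)))

  y² : (Fin (suc m) → Bool) → ℕ
  y² x = ΣF (λ i → c² i * bit (x i))

-- S_x is a path s = v₁ ⇝ w₁ → v₂ ⇝ ⋯ ⇝ wₙ = t (plus pendant edges {vᵢ, vᵢ′}), where vᵢ ⇝ wᵢ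
-- is the direct edge (length c²ᵢ + 2) if xᵢ = 1 and the detour through vᵢ′ (length 2) if
-- xᵢ = 0; the distance from s along it is 1-Lipschitz on S_x-edges, so d^S(s, t) = y² + 3n − 1
-- while the edge {s, t} has length 1. Conversely every edge of G is replaced in S_x by a walk
-- at most D := y² + 3n − 1 times as long: kept edges by themselves, {vᵢ′, wᵢ} by vᵢ′ → vᵢ → wᵢ
-- of length c²ᵢ + 3 ≤ D (this needs n ≥ 2), and {s, t} by the path. Replacing edge by edge,
-- every walk of G is stretched by at most D, so f₂ = D. Only the kept edges {vᵢ′, wᵢ} carry
-- c¹-weight, which gives f₁.
module Submission where

open import Defs
open import Data.Nat using (ℕ; zero; suc; _+_; _*_; _∸_; _≤_; z≤n; s≤s; >-nonZero)
open import Data.Nat.Properties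
open import Data.Nat.ListAction using (sum)
open import Data.Nat.ListAction.Properties using (sum-++)
open import Data.Fin using (Fin; zero; suc; inject₁)
open import Data.Fin.Induction using (<-weakInduction)
open import Data.Bool using (Bool; true; false; if_then_else_)
open import Data.Integer as ℤ using (ℤ; +_; -_)
import Data.Integer.Properties as ℤP
open import Data.Rational using (_/_)
import Data.Rational as ℚ
import Data.Rational.Properties as ℚP
import Data.Rational.Unnormalised as ℚᵘ
import Data.Rational.Unnormalised.Properties as ℚᵘP
open import Data.List using (List; []; _∷_; _++_; map; foldr; tabulate; allFin)
open import Data.List.Properties using (map-++; map-tabulate)
open import Data.Product using (Σ; _×_; _,_; proj₁; proj₂)
open import Data.Sum using (inj₁; inj₂; swap)
open import Data.Empty using (⊥-elim)
open import Function using (_∘_; id)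
open import Relation.Binary.PropositionalEquality
  using (_≡_; _≢_; refl; sym; trans; cong; cong₂; subst; subst₂; module ≡-Reasoning)
open import Algebra.Properties.CommutativeSemigroup +-commutativeSemigroup using (interchange)

ΣF-cong : ∀ {k} {f g : Fin k → ℕ} → (∀ i → f i ≡ g i) → ΣF f ≡ ΣF g
ΣF-cong {zero}  eq = refl
ΣF-cong {suc k} eq = cong₂ _+_ (eq zero) (ΣF-cong (eq ∘ suc))

ΣF-+ : ∀ {k} (f g : Fin k → ℕ) → ΣF (λ i → f i + g i) ≡ ΣF f + ΣF g
ΣF-+ {zero}  f g = refl
ΣF-+ {suc k} f g = trans (cong (_+_ (f zero + g zero)) (ΣF-+ (f ∘ suc) (g ∘ suc)))
                         (interchange (f zero) (g zero) _ _)

ΣF-const : ∀ k c → ΣF {k} (λ _ → c) ≡ k * c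
ΣF-const zero    c = refl
ΣF-const (suc k) c = cong (_+_ c) (ΣF-const k c)

ΣF-zero : ∀ k → ΣF {k} (λ _ → 0) ≡ 0
ΣF-zero k = trans (ΣF-const k 0) (*-zeroʳ k)

term≤ΣF : ∀ {k} (f : Fin k → ℕ) i → f i ≤ ΣF f
term≤ΣF f zero    = m≤m+n (f zero) _
term≤ΣF f (suc i) = ≤-trans (term≤ΣF (f ∘ suc) i) (m≤n+m _ (f zero))

sum-tabulate : ∀ {k} (f : Fin k → ℕ) → sum (tabulate f) ≡ ΣF f
sum-tabulate {zero}  f = refl
sum-tabulate {suc k} f = cong (_+_ (f zero)) (sum-tabulate (f ∘ suc))

sum-map-allFin : ∀ {A : Set} {k} (f : Fin k → A) (h : A → ℕ) →
                 sum (map h (map f (allFin k))) ≡ ΣF (h ∘ f)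
sum-map-allFin f h =
  trans (cong (sum ∘ map h) (map-tabulate id f))
        (trans (cong sum (map-tabulate f h)) (sum-tabulate (h ∘ f)))

sum-map-++ : ∀ {A : Set} (h : A → ℕ) (xs ys : List A) →
             sum (map h (xs ++ ys)) ≡ sum (map h xs) + sum (map h ys)
sum-map-++ h xs ys = trans (cong sum (map-++ h xs ys)) (sum-++ (map h xs) (map h ys))

prefix : ∀ {k} → (Fin (suc k) → ℕ) → Fin (suc k) → ℕ
prefix g zero = 0
prefix {suc k} g (suc i) = g zero + prefix (g ∘ suc) i

prefix-suc : ∀ {k} (g : Fin (suc k) → ℕ) (i : Fin k) →
             prefix g (suc i) ≡ prefix g (inject₁ i) + g (inject₁ i)
prefix-suc {suc k} g zero    = +-identityʳ (g zero)
prefix-suc {suc k} g (suc i) =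
  trans (cong (_+_ (g zero)) (prefix-suc (g ∘ suc) i)) (sym (+-assoc (g zero) _ _))

prefix-lastF : ∀ k (g : Fin (suc k) → ℕ) → prefix g (lastF k) + g (lastF k) ≡ ΣF g
prefix-lastF zero    g = sym (+-identityʳ (g zero))
prefix-lastF (suc k) g = trans (+-assoc (g zero) _ _) (cong (_+_ (g zero)) (prefix-lastF k (g ∘ suc)))

*-bit-≤ : ∀ c b → c * bit b ≤ c
*-bit-≤ c true  = ≤-reflexive (*-identityʳ c)
*-bit-≤ c false = ≤-trans (≤-reflexive (*-zeroʳ c)) z≤n

if-then-0-+-*-bit : ∀ b c → (if b then 0 else c) + c * bit b ≡ c
if-then-0-+-*-bit true  c = *-identityʳ c
if-then-0-+-*-bit false c = trans (cong (_+_ c) (*-zeroʳ c)) (+-identityʳ c)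

+[m+n]-+n≡+m : ∀ m n → + (m + n) ℤ.+ - (+ n) ≡ + m
+[m+n]-+n≡+m m n =
  trans (ℤP.m-n≡m⊖n (m + n) n) (trans (ℤP.⊖-≥ (m≤n+m n m)) (cong +_ (m+n∸n≡m m n)))

/-≤-/1 : ∀ a b D → a ≤ D * suc b → + a / suc b ℚ.≤ + D / 1
/-≤-/1 a b D le = ℚP.toℚᵘ-cancel-≤
  (ℚᵘP.≤-respˡ-≃ (ℚᵘP.≃-sym (ℚP.toℚᵘ-fromℚᵘ (ℚᵘ.mkℚᵘ (+ a) b)))
    (ℚᵘP.≤-respʳ-≃ (ℚᵘP.≃-sym (ℚP.toℚᵘ-fromℚᵘ (ℚᵘ.mkℚᵘ (+ D) 0)))
      (ℚᵘ.*≤* (subst₂ ℤ._≤_ (ℤP.pos-* a 1) (ℤP.pos-* D (suc b))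
         (ℤ.+≤+ (≤-trans (≤-reflexive (*-identityʳ a)) le))))))

module Walks {V E : Set} (ends : E → V × V) (edges : List E) (c₁ : E → ℤ) (c₂ : E → ℕ) where
  open GraphNotions ends edges c₁ c₂

  infixr 5 _++ʷ_ _++ₗ_

  _++ʷ_ : ∀ {F a b c} → Walk F a b → Walk F b c → Walk F a c
  [] ++ʷ q = q
  step e k j p ++ʷ q = step e k j (p ++ʷ q)

  len-++ʷ : ∀ {F a b c} (p : Walk F a b) (q : Walk F b c) → len (p ++ʷ q) ≡ len p + len q
  len-++ʷ []             q = refl
  len-++ʷ (step e _ _ p) q = trans (cong (_+_ (c₂ e)) (len-++ʷ p q)) (sym (+-assoc (c₂ e) _ _))

  reverse : ∀ {F a b} → Walk F a b → Walk F b a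
  reverse []             = []
  reverse (step e k j p) = reverse p ++ʷ step e k (swap j) []

  len-reverse : ∀ {F a b} (p : Walk F a b) → len (reverse p) ≡ len p
  len-reverse []             = refl
  len-reverse (step e k j p) =
    trans (len-++ʷ (reverse p) (step e k (swap j) []))
          (trans (cong₂ _+_ (len-reverse p) (+-identityʳ (c₂ e))) (+-comm (len p) (c₂ e)))

  WalkOfLength : (E → Bool) → V → V → ℕ → Set
  WalkOfLength F a b ℓ = Σ (Walk F a b) λ p → len p ≡ ℓ

  Within : (E → Bool) → V → V → ℕ → Set
  Within F a b ℓ = Σ (Walk F a b) λ p → len p ≤ ℓ

  edgeWalk : ∀ {F} e → F e ≡ true → WalkOfLength F (proj₁ (ends e)) (proj₂ (ends e)) (c₂ e)
  edgeWalk e kept = step e kept (inj₁ refl) [] , +-identityʳ (c₂ e)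

  _++ₗ_ : ∀ {F a b c k l} → WalkOfLength F a b k → WalkOfLength F b c l → WalkOfLength F a c (k + l)
  (p , refl) ++ₗ (q , refl) = p ++ʷ q , len-++ʷ p q

  reverseₗ : ∀ {F a b k} → WalkOfLength F a b k → WalkOfLength F b a k
  reverseₗ (p , refl) = reverse p , len-reverse p

  reverseWithin : ∀ {F a b ℓ} → Within F a b ℓ → Within F b a ℓ
  reverseWithin (p , le) = reverse p , ≤-trans (≤-reflexive (len-reverse p)) le

  EdgesStretched : (E → Bool) → ℕ → Set
  EdgesStretched F D = ∀ {a b} e → Joins e a b → Within F a b (D * c₂ e)

  edgesStretched : ∀ {F D} →
    (∀ e → Within F (proj₁ (ends e)) (proj₂ (ends e)) (D * c₂ e)) → EdgesStretched F D
  edgesStretched {F} {D} within e (inj₁ eq) =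
    subst (λ ab → Within F (proj₁ ab) (proj₂ ab) (D * c₂ e)) eq (within e)
  edgesStretched {F} {D} within e (inj₂ eq) =
    reverseWithin (subst (λ ab → Within F (proj₁ ab) (proj₂ ab) (D * c₂ e)) eq (within e))

  stretchWalk : ∀ {F G D} → EdgesStretched F D → ∀ {a b} (p : Walk G a b) → Within F a b (D * len p)
  stretchWalk stretched []             = [] , z≤n
  stretchWalk {F} {D = D} stretched {a} (step {x = y} e _ j p)
    with stretched {a} {y} e j | stretchWalk {F} {D = D} stretched p
  ... | q₁ , le₁ | q₂ , le₂ =
    q₁ ++ʷ q₂ ,
    ≤-trans (≤-reflexive (len-++ʷ q₁ q₂))
      (≤-trans (+-mono-≤ le₁ le₂) (≤-reflexive (sym (*-distribˡ-+ D (c₂ e) (len p)))))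

  ratio≤ : ∀ a b D → a ≤ D * b → ratio a b ℚ.≤ + D / 1
  ratio≤ a zero    D _  = /-≤-/1 0 0 D z≤n
  ratio≤ a (suc b) D le = /-≤-/1 a b D le

  stretched⇒ratio≤ : ∀ {F D} → EdgesStretched F D →
    ∀ a b → a ≢ b → ∀ dS dE → IsDist F a b dS → IsDist allE a b dE → ratio dS dE ℚ.≤ + D / 1
  stretched⇒ratio≤ {F} {D} stretched _ _ _ dS dE (_ , shortest) ((p , refl) , _)
    with stretchWalk {F} {D = D} stretched p
  ... | q , le = ratio≤ dS (len p) D (≤-trans (shortest q) le)

  potential-≤-len : ∀ {F} (φ : V → ℕ) →
    (∀ e → F e ≡ true → φ (proj₂ (ends e)) ≤ φ (proj₁ (ends e)) + c₂ e
                      × φ (proj₁ (ends e)) ≤ φ (proj₂ (ends e)) + c₂ e) →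
    ∀ {a b} (p : Walk F a b) → φ b ≤ φ a + len p
  potential-≤-len φ edgeBound {a} [] = m≤m+n (φ a) 0
  potential-≤-len {F} φ edgeBound {a} (step e kept j p) =
    ≤-trans (potential-≤-len φ edgeBound p)
      (≤-trans (+-monoˡ-≤ (len p) (alongEdge j)) (≤-reflexive (+-assoc (φ a) (c₂ e) (len p))))
    where
    alongEdge : ∀ {a b} → Joins e a b → φ b ≤ φ a + c₂ e
    alongEdge (inj₁ eq) = subst (λ ab → φ (proj₂ ab) ≤ φ (proj₁ ab) + c₂ e) eq (proj₁ (edgeBound e kept))
    alongEdge (inj₂ eq) = subst (λ ab → φ (proj₁ ab) ≤ φ (proj₂ ab) + c₂ e) eq (proj₂ (edgeBound e kept))

  1≤len : (∀ e → 1 ≤ c₂ e) → ∀ {F a b} → a ≢ b → (p : Walk F a b) → 1 ≤ len p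
  1≤len positive a≢b []             = ⊥-elim (a≢b refl)
  1≤len positive _   (step e _ _ p) = ≤-trans (positive e) (m≤m+n (c₂ e) (len p))

  f₁≡sum : ∀ F (h : E → ℕ) → (∀ e → (if F e then c₁ e else + 0) ≡ + h e) →
           f₁ F ≡ + sum (map h edges)
  f₁≡sum F h weight = go edges
    where
    go : ∀ l → foldr (λ e acc → (if F e then c₁ e else + 0) ℤ.+ acc) (+ 0) l ≡ + sum (map h l)
    go []      = refl
    go (e ∷ l) = cong₂ ℤ._+_ (weight e) (go l)

sum-edgeList : ∀ m (h : Edg m → ℕ) → sum (map h (edgeList m))
             ≡ ΣF (h ∘ vw) + (ΣF (h ∘ vv′) + (ΣF (h ∘ v′w) + (ΣF (h ∘ wv) + (h st + 0))))
sum-edgeList m h =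
  trans (sum-map-++ h (map vw all) _) (cong₂ _+_ (sum-map-allFin vw h)
  (trans (sum-map-++ h (map vv′ all) _) (cong₂ _+_ (sum-map-allFin vv′ h)
  (trans (sum-map-++ h (map v′w all) _) (cong₂ _+_ (sum-map-allFin v′w h)
  (trans (sum-map-++ h (map wv (allFin m)) _) (cong (_+ (h st + 0)) (sum-map-allFin wv h))))))))
  where all = allFin (suc m)

module PathSpanner (m : ℕ) (c¹ c² : Fin (suc m) → ℕ) (x : Fin (suc m) → Bool) where
  open Construction m c¹ c²
  open Walks ends (edgeList m) w₁ w₂

  Sₓ : Edg m → Bool
  Sₓ = S_ x

  s t : Vtx m
  s = v zero
  t = w (lastF m)

  D : ℕ
  D = y² x + 3 * suc m ∸ 1

  c²x : Fin (suc m) → ℕ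
  c²x i = c² i * bit (x i)

  segment : Fin (suc m) → ℕ
  segment i = c²x i + 3

  -- dₛ a is the c₂-distance from s to a in (V, S_x).
  dₛ : Vtx m → ℕ
  dₛ (v i)  = prefix segment i
  dₛ (v′ i) = prefix segment i + 1
  dₛ (w i)  = prefix segment i + (c²x i + 2)

  c²x-true : ∀ {i} → x i ≡ true → c²x i ≡ c² i
  c²x-true {i} eq = trans (cong (λ b → c² i * bit b) eq) (*-identityʳ (c² i))

  kept-v′w : ∀ {i} → x i ≡ false → Sₓ (v′w i) ≡ true
  kept-v′w eq = cong (λ b → if b then false else true) eq

  dₛ-w+1 : ∀ i → dₛ (w i) + 1 ≡ prefix segment i + segment i
  dₛ-w+1 i = trans (+-assoc (prefix segment i) (c²x i + 2) 1)
                   (cong (_+_ (prefix segment i)) (+-assoc (c²x i) 2 1))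

  dₛ-v-suc : ∀ k → dₛ (v (suc k)) ≡ dₛ (w (inject₁ k)) + 1
  dₛ-v-suc k = trans (prefix-suc segment k) (sym (dₛ-w+1 (inject₁ k)))

  dₛ-t : dₛ t ≡ D
  dₛ-t = begin
    dₛ t                                             ≡⟨ m+n∸n≡m (dₛ t) 1 ⟨
    dₛ t + 1 ∸ 1                                     ≡⟨ cong (_∸ 1) (dₛ-w+1 (lastF m)) ⟩
    prefix segment (lastF m) + segment (lastF m) ∸ 1 ≡⟨ cong (_∸ 1) (prefix-lastF m segment) ⟩
    ΣF segment ∸ 1                                   ≡⟨ cong (_∸ 1) ΣF-segment ⟩
    D                                                ∎
    where
    open ≡-Reasoning
    ΣF-segment : ΣF segment ≡ y² x + 3 * suc m
    ΣF-segment = trans (ΣF-+ c²x (λ _ → 3))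
                       (cong (_+_ (y² x)) (trans (ΣF-const (suc m) 3) (*-comm (suc m) 3)))

  v→w : ∀ i → WalkOfLength Sₓ (v i) (w i) (c²x i + 2)
  v→w i with x i in eq
  ... | true  = subst (WalkOfLength Sₓ (v i) (w i)) (cong (_+ 2) (sym (*-identityʳ (c² i))))
                      (edgeWalk (vw i) refl)
  ... | false = subst (WalkOfLength Sₓ (v i) (w i)) (cong (_+ 2) (sym (*-zeroʳ (c² i))))
                      (edgeWalk (vv′ i) refl ++ₗ edgeWalk (v′w i) (kept-v′w eq))

  s→v : ∀ i → WalkOfLength Sₓ s (v i) (dₛ (v i))
  s→v = <-weakInduction (λ i → WalkOfLength Sₓ s (v i) (dₛ (v i))) ([] , refl) extend
    where
    extend : ∀ k → WalkOfLength Sₓ s (v (inject₁ k)) (dₛ (v (inject₁ k))) →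
             WalkOfLength Sₓ s (v (suc k)) (dₛ (v (suc k)))
    extend k p = subst (WalkOfLength Sₓ s (v (suc k))) (sym (dₛ-v-suc k))
                       ((p ++ₗ v→w (inject₁ k)) ++ₗ edgeWalk (wv k) refl)

  s→ : ∀ a → WalkOfLength Sₓ s a (dₛ a)
  s→ (v i)  = s→v i
  s→ (v′ i) = s→v i ++ₗ edgeWalk (vv′ i) refl
  s→ (w i)  = s→v i ++ₗ v→w i

  connected : Connected Sₓ
  connected a b = reverse (proj₁ (s→ a)) ++ʷ proj₁ (s→ b)

  dₛ-edge : ∀ e → Sₓ e ≡ true → dₛ (proj₁ (ends e)) ≤ dₛ (proj₂ (ends e))
                             × dₛ (proj₂ (ends e)) ≤ dₛ (proj₁ (ends e)) + w₂ e
  dₛ-edge (vw i) _ =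
    m≤m+n (prefix segment i) _ ,
    +-monoʳ-≤ (prefix segment i) (+-monoˡ-≤ 2 (*-bit-≤ (c² i) (x i)))
  dₛ-edge (vv′ i) _ = m≤m+n (prefix segment i) 1 , ≤-refl
  dₛ-edge (v′w i) kept with x i
  dₛ-edge (v′w i) () | true
  ... | false =
    +-monoʳ-≤ (prefix segment i) (≤-trans (n≤1+n 1) (m≤n+m 2 (c² i * 0))) ,
    ≤-reflexive (trans (cong (λ c → prefix segment i + (c + 2)) (*-zeroʳ (c² i)))
                       (sym (+-assoc (prefix segment i) 1 1)))
  dₛ-edge (wv k) _ =
    ≤-trans (m≤m+n _ 1) (≤-reflexive (sym (dₛ-v-suc k))) , ≤-reflexive (dₛ-v-suc k)
  dₛ-edge st ()

  dist-s-t : IsDist Sₓ s t D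
  dist-s-t =
    subst (WalkOfLength Sₓ s t) dₛ-t (s→ t) ,
    λ p → subst (_≤ len p) dₛ-t (potential-≤-len dₛ lipschitz p)
    where
    lipschitz : ∀ e → Sₓ e ≡ true → dₛ (proj₂ (ends e)) ≤ dₛ (proj₁ (ends e)) + w₂ e
                                 × dₛ (proj₁ (ends e)) ≤ dₛ (proj₂ (ends e)) + w₂ e
    lipschitz e kept with dₛ-edge e kept
    ... | monotone , bounded = bounded , ≤-trans monotone (m≤m+n _ (w₂ e))

  dist-s-t-in-G : IsDist allE s t 1
  dist-s-t-in-G = edgeWalk st refl , 1≤len positive (λ ())
    where
    positive : ∀ e → 1 ≤ w₂ e
    positive (vw i)  = ≤-trans (n≤1+n 1) (m≤n+m 2 (c² i))
    positive (vv′ i) = ≤-refl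
    positive (v′w i) = ≤-refl
    positive (wv i)  = ≤-refl
    positive st      = ≤-refl

  1≤D : 1 ≤ D
  1≤D = ∸-monoˡ-≤ 1 (≤-trans (n≤1+n 2) (≤-trans (*-monoʳ-≤ 3 (s≤s (z≤n {m}))) (m≤n+m _ (y² x))))

  detour≤D : 1 ≤ m → ∀ {i} → x i ≡ true → 1 + (c² i + 2) ≤ D * 1
  detour≤D 1≤m {i} eq = ≤-trans (≤-reflexive (cong (_+_ 1) (+-comm (c² i) 2)))
    (≤-trans (∸-monoˡ-≤ 1 (≤-trans (+-mono-≤ four≤3n c²≤y²) (≤-reflexive (+-comm _ (y² x)))))
             (≤-reflexive (sym (*-identityʳ D))))
    where
    four≤3n : 4 ≤ 3 * suc m
    four≤3n = ≤-trans (m≤m+n 4 2) (*-monoʳ-≤ 3 (s≤s 1≤m))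
    c²≤y² : c² i ≤ y² x
    c²≤y² = subst (_≤ y² x) (c²x-true eq) (term≤ΣF c²x i)

  keptWithin : ∀ e → Sₓ e ≡ true → Within Sₓ (proj₁ (ends e)) (proj₂ (ends e)) (D * w₂ e)
  keptWithin e kept with edgeWalk e kept
  ... | p , lenp = p , ≤-trans (≤-reflexive lenp) (m≤n*m (w₂ e) D {{>-nonZero 1≤D}})

  stretched : 1 ≤ m → ∀ e → Within Sₓ (proj₁ (ends e)) (proj₂ (ends e)) (D * w₂ e)
  stretched _ (vw i)  = keptWithin (vw i) refl
  stretched _ (vv′ i) = keptWithin (vv′ i) refl
  stretched 1≤m (v′w i) with x i in eq
  ... | false = keptWithin (v′w i) (kept-v′w eq)
  ... | true  with reverseₗ (edgeWalk (vv′ i) refl) ++ₗ edgeWalk (vw i) refl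
  ...   | p , lenp = p , ≤-trans (≤-reflexive lenp) (detour≤D 1≤m eq)
  stretched _ (wv k)  = keptWithin (wv k) refl
  stretched _ st with s→ t
  ... | p , lenp = p , ≤-reflexive (trans lenp (trans dₛ-t (sym (*-identityʳ D))))

  f₂-Sₓ : 1 ≤ m → F₂Is Sₓ (+ D / 1)
  f₂-Sₓ 1≤m =
    stretched⇒ratio≤ {Sₓ} {D} (edgesStretched {Sₓ} {D} (stretched 1≤m)) ,
    s , t , (λ ()) , D , 1 , dist-s-t , dist-s-t-in-G , refl

  cost¹ : Edg m → ℕ
  cost¹ (v′w i) = if x i then 0 else c¹ i
  cost¹ _       = 0

  cost¹-weight : ∀ e → (if Sₓ e then w₁ e else + 0) ≡ + cost¹ e
  cost¹-weight (vw i)  = refl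
  cost¹-weight (vv′ i) = refl
  cost¹-weight (v′w i) with x i
  ... | true  = refl
  ... | false = refl
  cost¹-weight (wv i)  = refl
  cost¹-weight st      = refl

  f₁-Sₓ : f₁ Sₓ ≡ + C¹ ℤ.+ y¹ x
  f₁-Sₓ = begin
    f₁ Sₓ                                      ≡⟨ f₁≡sum Sₓ cost¹ cost¹-weight ⟩
    + sum (map cost¹ (edgeList m))             ≡⟨ cong +_ (trans (sum-edgeList m cost¹) onlyKept) ⟩
    + kept                                     ≡⟨ +[m+n]-+n≡+m kept dropped ⟨
    + (kept + dropped) ℤ.+ - (+ dropped)       ≡⟨ cong (λ n → + n ℤ.+ y¹ x) split ⟩
    + C¹ ℤ.+ y¹ x                              ∎
    where
    open ≡-Reasoning
    kept dropped : ℕ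
    kept    = ΣF (cost¹ ∘ v′w)
    dropped = ΣF (λ i → c¹ i * bit (x i))
    onlyKept : ΣF (cost¹ ∘ vw) + (ΣF (cost¹ ∘ vv′) + (kept + (ΣF (cost¹ ∘ wv) + 0))) ≡ kept
    onlyKept = trans (cong₂ _+_ (ΣF-zero (suc m)) (cong₂ _+_ (ΣF-zero (suc m))
                       (cong (_+_ kept) (cong (_+ 0) (ΣF-zero m)))))
                     (+-identityʳ kept)
    split : kept + dropped ≡ C¹
    split = trans (sym (ΣF-+ (cost¹ ∘ v′w) (λ i → c¹ i * bit (x i))))
                  (ΣF-cong (λ i → if-then-0-+-*-bit (x i) (c¹ i)))

lemma5 : (m : ℕ) → 1 ≤ m →
    (c¹ c² : Fin (suc m) → ℕ) → (∀ i → 1 ≤ c¹ i) → (∀ i → 1 ≤ c² i) →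
    (x : Fin (suc m) → Bool) →
    let open Construction m c¹ c² in
    IsSpanner (S_ x)
      × (f₁ (S_ x) ≡ (+ C¹) ℤ.+ y¹ x)
      × F₂Is (S_ x) ((+ (y² x + 3 * suc m ∸ 1)) / 1)
lemma5 m 1≤m c¹ c² _ _ x = connected , f₁-Sₓ , f₂-Sₓ 1≤m
  where open PathSpanner m c¹ c² x
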